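{- For a graph $G$, the following are equivalent: (1) $G$ is a forest; (2) $G$ is $2$-repeating; (3) $G$ is $4$-repeating.
   Context: For $q\in\mathbb{N}$, a closed walk $(v_0,v_1,\dots,v_r=v_0)$ is $q$-repeating if there exist $0\le t<t'\le r-1$ with $t\equiv t'\pmod q$ and $v_t=v_{t'}$. A graph is $q$-repeating if for every integer $j\ge2$, every closed walk on it of length $jq$ (number of edges, counted with repetition) is $q$-repeating. A forest is an acyclic graph. -}

module Defs where

open import Level using (0ℓ)
open import Data.Nat using (ℕ; zero; suc; _+_; _*_; _<_; _≤_; NonZero)
open import Data.Nat.DivMod using (_%_)
open import Data.Fin using (Fin)
open import Data.Product using (Σ; _×_; ∃; ∃-syntax)
open import Relation.Binary.PropositionalEquality using (_≡_)
open import Relation.Nullary using (¬_)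

record SimpleGraph (n : ℕ) : Set₁ where
  field
    Adj   : Fin n → Fin n → Set
    sym   : ∀ {u v} → Adj u v → Adj v u
    irrefl : ∀ {v} → ¬ Adj v v

open SimpleGraph public

IsClosedWalk : ∀ {n} → SimpleGraph n → ℕ → (ℕ → Fin n) → Set
IsClosedWalk G r w = (w r ≡ w 0) × (∀ i → i < r → Adj G (w i) (w (suc i)))

QRepeatingWalk : (q : ℕ) → .{{NonZero q}} → ∀ {n} → ℕ → (ℕ → Fin n) → Set
QRepeatingWalk q r w =
  ∃[ t ] ∃[ t' ] (t < t') × (t' < r) × (t % q ≡ t' % q) × (w t ≡ w t')

QRepeating : (q : ℕ) → .{{NonZero q}} → ∀ {n} → SimpleGraph n → Set
QRepeating q G =
  ∀ (j : ℕ) → 2 ≤ j → (w : ℕ → Fin _) →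
    IsClosedWalk G (j * q) w → QRepeatingWalk q (j * q) w

IsCycle : ∀ {n} → SimpleGraph n → ℕ → (ℕ → Fin n) → Set
IsCycle G k c =
  (3 ≤ k) × IsClosedWalk G k c ×
  (∀ i j → i < k → j < k → c i ≡ c j → i ≡ j)

Forest : ∀ {n} → SimpleGraph n → Set
Forest G = ¬ (∃[ k ] ∃[ c ] IsCycle G k c)

-- Cancelling immediate backtracks reduces every walk w 0, …, w t to a
-- non-backtracking walk from w 0 to w t, of length h t say.  A closed
-- non-backtracking walk of positive length contains a cycle, so in a forest a
-- closed walk of length r has h r = 0.  The profile h moves by ±1, and whenever
-- h stays above h a on [a, b] with h b = h a, the reduced walk at a is restored
-- at b, so w a = w b.  An excursion of h of length 2m contains one of length
-- exactly 2d whenever d ≤ 2 and d ≤ m; this gives w o = w (o + q) for q = 2, 4,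
-- hence a q-repetition.
--
-- Conversely, going lcm q k steps round a k-cycle with k ∤ q is a closed walk
-- of length j q, j ≥ 2, whose q-repetitions would be a multiple of lcm q k
-- apart.  For q = k = 4 the walk c₀c₁c₀c₁c₂c₃c₂c₃ does the job instead.

module Submission where

open import Data.Empty using (⊥-elim)
open import Data.Fin using (Fin)
import Data.Fin.Properties as Fin
open import Data.List using (List; []; _∷_; length)
open import Data.List.Relation.Binary.Pointwise using (_∷_; ≡⇒Pointwise-≡; Pointwise-length)
open import Data.List.Relation.Binary.Suffix.Heterogeneous using (Suffix; here; there)
open import Data.List.Relation.Binary.Suffix.Heterogeneous.Properties using (toPointwise)
open import Data.Nat
  using (ℕ; zero; suc; _+_; _*_; _∸_; _≤_; _<_; z≤n; s≤s; z<s; s≤s⁻¹; _≟_; _<?_; _/_; _%_;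
         NonZero; ≢-nonZero; ≢-nonZero⁻¹; >-nonZero; >-nonZero⁻¹)
open import Data.Nat.Properties
open import Data.Nat.DivMod
open import Data.Nat.Divisibility
open import Data.Nat.GCD using (gcd)
open import Data.Nat.Induction using (<-rec)
open import Data.Nat.LCM using (lcm; m∣lcm[m,n]; n∣lcm[m,n]; lcm-least; gcd*lcm)
open import Data.Product using (∃-syntax; _×_; _,_; proj₁; proj₂)
open import Data.Sum using (_⊎_; inj₁; inj₂)
open import Data.Unit using (⊤)
open import Function.Base using (_∘_)
open import Function.Bundles using (_⇔_; mk⇔)
open import Relation.Binary.Definitions using (tri<; tri≈; tri>)
open import Relation.Binary.PropositionalEquality
open import Relation.Nullary using (¬_; yes; no; contradiction)
open import Relation.Nullary.Decidable using (_×-dec_)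

open import Defs hiding (sym)
open SimpleGraph using () renaming (sym to adj-sym)

%≡%⇒∣∸ : ∀ {a b} q .{{_ : NonZero q}} → a ≤ b → a % q ≡ b % q → q ∣ b ∸ a
%≡%⇒∣∸ {a} {b} q a≤b a%q≡b%q = divides (b / q ∸ a / q) (begin
  b ∸ a                                          ≡⟨ cong₂ _∸_ (m≡m%n+[m/n]*n b q) (m≡m%n+[m/n]*n a q) ⟩
  (b % q + (b / q) * q) ∸ (a % q + (a / q) * q)  ≡⟨ cong (λ r → (b % q + (b / q) * q) ∸ (r + (a / q) * q)) a%q≡b%q ⟩
  (b % q + (b / q) * q) ∸ (b % q + (a / q) * q)  ≡⟨ [m+n]∸[m+o]≡n∸o (b % q) _ _ ⟩
  (b / q) * q ∸ (a / q) * q                      ≡⟨ *-distribʳ-∸ q (b / q) (a / q) ⟨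
  (b / q ∸ a / q) * q                            ∎)
  where open ≡-Reasoning

≤-one-of-two-parts : ∀ {d m₁ m₂} → d ≤ 2 → 1 ≤ m₁ → 1 ≤ m₂ → d < m₁ + m₂ → d ≤ m₁ ⊎ d ≤ m₂
≤-one-of-two-parts {0}                 _              _    _ _          = inj₁ z≤n
≤-one-of-two-parts {1}                 _              1≤m₁ _ _          = inj₁ 1≤m₁
≤-one-of-two-parts {2} {suc (suc _)}   _              _    _ _          = inj₁ (s≤s (s≤s z≤n))
≤-one-of-two-parts {2} {1}             _              _    _ (s≤s 2≤m₂) = inj₂ 2≤m₂
≤-one-of-two-parts {suc (suc (suc _))} (s≤s (s≤s ())) _    _ _

[1+m]%n≡[1+m%n]%n : ∀ m n .{{_ : NonZero n}} → suc m % n ≡ suc (m % n) % n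
[1+m]%n≡[1+m%n]%n m n =
  trans (cong (λ x → suc x % n) (m≡m%n+[m/n]*n m n)) ([m+kn]%n≡m%n (suc (m % n)) (m / n) n)

lcm≢0 : ∀ m n .{{_ : NonZero m}} .{{_ : NonZero n}} → NonZero (lcm m n)
lcm≢0 m n = ≢-nonZero λ lcm≡0 → ≢-nonZero⁻¹ (m * n) {{m*n≢0 m n}} (begin
  m * n             ≡⟨ gcd*lcm m n ⟨
  gcd m n * lcm m n ≡⟨ cong (gcd m n *_) lcm≡0 ⟩
  gcd m n * 0       ≡⟨ *-zeroʳ (gcd m n) ⟩
  0                 ∎)
  where open ≡-Reasoning

n∤m⇒lcm[m,n]≡j*m∧2≤j : ∀ m n .{{_ : NonZero m}} .{{_ : NonZero n}} → ¬ (n ∣ m) →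
  ∃[ j ] (lcm m n ≡ j * m × 2 ≤ j)
n∤m⇒lcm[m,n]≡j*m∧2≤j m n n∤m = quotient m∣l , equality m∣l , quotient>1 m∣l m<l
  where
  instance
    lcm≢0′ : NonZero (lcm m n)
    lcm≢0′ = lcm≢0 m n
  m∣l : m ∣ lcm m n
  m∣l = m∣lcm[m,n] m n
  open _∣_
  m<l : m < lcm m n
  m<l = ≤∧≢⇒< (∣⇒≤ m∣l) λ m≡l → n∤m (subst (n ∣_) (sym m≡l) (n∣lcm[m,n] m n))

divisor-of-4 : ∀ {k} → 3 ≤ k → k ∣ 4 → k ≡ 4
divisor-of-4 {1} (s≤s ()) _
divisor-of-4 {2} (s≤s (s≤s ())) _
divisor-of-4 {3} _ (divides 0 ())
divisor-of-4 {3} _ (divides 1 ())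
divisor-of-4 {3} _ (divides (suc (suc _)) ())
divisor-of-4 {4} _ _ = refl
divisor-of-4 {suc (suc (suc (suc (suc k))))} _ k∣4 = contradiction (∣⇒≤ k∣4) (m+n≮m 4 k)

congruent-below-2*q : ∀ q .{{_ : NonZero q}} {t t′} → t < t′ → t′ < 2 * q → t % q ≡ t′ % q → t′ ≡ q + t
congruent-below-2*q q {t} {t′} t<t′ t′<2q t≡t′[q] with %≡%⇒∣∸ q (<⇒≤ t<t′) t≡t′[q]
... | divides 0             t′∸t≡0 = contradiction t′∸t≡0 (>⇒≢ (m<n⇒0<n∸m t<t′))
... | divides 1             t′∸t≡q = begin
  t′           ≡⟨ m+[n∸m]≡n (<⇒≤ t<t′) ⟨
  t + (t′ ∸ t) ≡⟨ cong (t +_) (trans t′∸t≡q (+-identityʳ q)) ⟩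
  t + q        ≡⟨ +-comm t q ⟩
  q + t        ∎
  where open ≡-Reasoning
... | divides (suc (suc p)) t′∸t≡ = contradiction (begin
  2 * q                    ≡⟨ cong (q +_) (+-identityʳ q) ⟩
  q + q                    ≤⟨ +-monoʳ-≤ q (m≤m+n q (p * q)) ⟩
  suc (suc p) * q          ≡⟨ t′∸t≡ ⟨
  t′ ∸ t                   ≤⟨ m∸n≤m t′ t ⟩
  t′                       ∎) (<⇒≱ t′<2q)
  where open ≤-Reasoning

UnitSteps : (ℕ → ℕ) → Set
UnitSteps f = ∀ t → f (suc t) ≡ suc (f t) ⊎ suc (f (suc t)) ≡ f t

Excursion : (ℕ → ℕ) → ℕ → ℕ → Set
Excursion f a l = f (l + a) ≡ f a × (∀ u → u ≤ l → f a ≤ f (u + a))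

ContainsExcursion : (ℕ → ℕ) → ℕ → ℕ → ℕ → Set
ContainsExcursion f a l l′ = ∃[ o ] (o + l′ ≤ l × Excursion f (o + a) l′)

containsExcursion-shift : ∀ {f a} c {l₁ l l′} → c + l₁ ≤ l →
  ContainsExcursion f (c + a) l₁ l′ → ContainsExcursion f a l l′
containsExcursion-shift {f} {a} c {l₁} {l} {l′} c+l₁≤l (o , o+l′≤l₁ , ex) =
  o + c , bound , subst (λ b → Excursion f b l′) (sym (+-assoc o c a)) ex
  where
  bound : o + c + l′ ≤ l
  bound = begin
    o + c + l′   ≡⟨ +-assoc o c l′ ⟩
    o + (c + l′) ≡⟨ cong (o +_) (+-comm c l′) ⟩
    o + (l′ + c) ≡⟨ +-assoc o l′ c ⟨
    o + l′ + c   ≤⟨ +-monoˡ-≤ c o+l′≤l₁ ⟩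
    l₁ + c       ≡⟨ +-comm l₁ c ⟩
    c + l₁       ≤⟨ c+l₁≤l ⟩
    l            ∎
    where open ≤-Reasoning

module _ {f : ℕ → ℕ} (steps : UnitSteps f) where

  step-up : ∀ t → f t ≤ f (suc t) → f (suc t) ≡ suc (f t)
  step-up t ft≤ with steps t
  ... | inj₁ up   = up
  ... | inj₂ down = contradiction (subst (_≤ f (suc t)) (sym down) ft≤) 1+n≰n

  step-down : ∀ t → f (suc t) ≤ f t → suc (f (suc t)) ≡ f t
  step-down t ≤ft with steps t
  ... | inj₁ up   = contradiction (subst (_≤ f t) up ≤ft) 1+n≰n
  ... | inj₂ down = down

  parity-invariant : ∀ a l → (f (l + a) + l) % 2 ≡ f a % 2
  parity-invariant a zero    = cong (_% 2) (+-identityʳ (f a))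
  parity-invariant a (suc l) with steps (l + a)
  ... | inj₁ up = begin
    (f (suc l + a) + suc l) % 2       ≡⟨ cong (λ h → (h + suc l) % 2) up ⟩
    (suc (f (l + a)) + suc l) % 2     ≡⟨ cong (λ k → suc k % 2) (+-suc (f (l + a)) l) ⟩
    (2 + (f (l + a) + l)) % 2         ≡⟨ %-remove-+ˡ (f (l + a) + l) (∣-refl {2}) ⟩
    (f (l + a) + l) % 2               ≡⟨ parity-invariant a l ⟩
    f a % 2                           ∎
    where open ≡-Reasoning
  ... | inj₂ down = begin
    (f (suc l + a) + suc l) % 2       ≡⟨ cong (_% 2) (+-suc (f (suc l + a)) l) ⟩
    (suc (f (suc l + a)) + l) % 2     ≡⟨ cong (λ h → (h + l) % 2) down ⟩
    (f (l + a) + l) % 2               ≡⟨ parity-invariant a l ⟩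
    f a % 2                           ∎
    where open ≡-Reasoning

  return⇒even : ∀ a l → f (l + a) ≡ f a → ∃[ m ] l ≡ 2 * m
  return⇒even a l ret with %≡%⇒∣∸ 2 (m≤m+n (f a) l) (sym (trans (cong (λ h → (h + l) % 2) (sym ret)) (parity-invariant a l)))
  ... | divides m l≡m*2 = m , trans (sym (m+n∸m≡n (f a) l)) (trans l≡m*2 (*-comm m 2))

  excursion-split : ∀ {a l c} → Excursion f a l → c ≤ l → f (c + a) ≡ f a →
    Excursion f a c × Excursion f (c + a) (l ∸ c)
  excursion-split {a} {l} {c} (ret , lower) c≤l f[c+a]≡fa =
    (f[c+a]≡fa , λ u u≤c → lower u (≤-trans u≤c c≤l)) , (ret′ , lower′)
    where
    open ≡-Reasoning
    ret′ : f (l ∸ c + (c + a)) ≡ f (c + a)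
    ret′ = begin
      f (l ∸ c + (c + a)) ≡⟨ cong f (+-assoc (l ∸ c) c a) ⟨
      f (l ∸ c + c + a)   ≡⟨ cong (λ x → f (x + a)) (m∸n+n≡m c≤l) ⟩
      f (l + a)           ≡⟨ ret ⟩
      f a                 ≡⟨ f[c+a]≡fa ⟨
      f (c + a)           ∎
    lower′ : ∀ u → u ≤ l ∸ c → f (c + a) ≤ f (u + (c + a))
    lower′ u u≤l∸c rewrite f[c+a]≡fa | sym (+-assoc u c a) =
      lower (u + c) (subst (u + c ≤_) (m∸n+n≡m c≤l) (+-monoˡ-≤ c u≤l∸c))

  excursion-halves : ∀ {a m c} → Excursion f a (2 * m) → 0 < c → c < 2 * m → f (c + a) ≡ f a →
    ∃[ m₁ ] ∃[ m₂ ] (m₁ + m₂ ≡ m × 1 ≤ m₁ × 1 ≤ m₂ × Excursion f a (2 * m₁) × Excursion f (2 * m₁ + a) (2 * m₂))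
  excursion-halves {a} {m} {c} ex 0<c c<2m ret with return⇒even a c ret
  ... | m₁ , refl with excursion-split ex (<⇒≤ c<2m) ret
  ...   | ex₁ , ex₂ =
    m₁ , m ∸ m₁ , m+[n∸m]≡n (<⇒≤ m₁<m) , *-cancelˡ-< 2 0 m₁ 0<c , m<n⇒0<n∸m m₁<m ,
    ex₁ , subst (Excursion f (2 * m₁ + a)) (sym (*-distribˡ-∸ 2 m m₁)) ex₂
    where
    m₁<m : m₁ < m
    m₁<m = *-cancelˡ-< 2 m₁ m c<2m

  excursion-inner : ∀ {a l} → Excursion f a (2 + l) →
    (∀ c → 0 < c → c < 2 + l → f (c + a) ≢ f a) → Excursion f (1 + a) l
  excursion-inner {a} {l} (ret , lower) noReturn = ret′ , lower′
    where
    first : f (1 + a) ≡ suc (f a)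
    first = step-up a (lower 1 (s≤s z≤n))
    last : f (1 + l + a) ≡ suc (f a)
    last = trans (sym (step-down (1 + l + a) (subst (_≤ f (1 + l + a)) (sym ret) (lower (1 + l) (n≤1+n _))))) (cong suc ret)
    ret′ : f (l + (1 + a)) ≡ f (1 + a)
    ret′ = trans (cong f (+-suc l a)) (trans last (sym first))
    lower′ : ∀ u → u ≤ l → f (1 + a) ≤ f (u + (1 + a))
    lower′ u u≤l rewrite first | +-suc u a =
      ≤∧≢⇒< (lower (suc u) (s≤s (m≤n⇒m≤1+n u≤l))) (λ e → noReturn (suc u) z<s (s≤s (s≤s u≤l)) (sym e))

  -- The restriction d ≤ 2 is what makes the induction work: when an excursion
  -- splits into two shorter ones, one of them is still at least 2 * d long.
  excursion⇒containsExcursion : ∀ {d} → d ≤ 2 → ∀ m {a} → d ≤ m → Excursion f a (2 * m) →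
    ContainsExcursion f a (2 * m) (2 * d)
  excursion⇒containsExcursion {d} d≤2 = <-rec _ go
    where
    go : ∀ m → (∀ {m′} → m′ < m → ∀ {a} → d ≤ m′ → Excursion f a (2 * m′) → ContainsExcursion f a (2 * m′) (2 * d)) →
      ∀ {a} → d ≤ m → Excursion f a (2 * m) → ContainsExcursion f a (2 * m) (2 * d)
    go m rec {a} d≤m ex with m≤n⇒m<n∨m≡n d≤m
    ... | inj₂ refl = 0 , ≤-refl , ex
    ... | inj₁ d<m with anyUpTo? (λ c → (0 <? c) ×-dec (f (c + a) ≟ f a)) (2 * m)
    ...   | yes (c , c<2m , 0<c , ret) with excursion-halves {m = m} ex 0<c c<2m ret
    ...     | m₁ , m₂ , refl , 1≤m₁ , 1≤m₂ , ex₁ , ex₂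
            with ≤-one-of-two-parts d≤2 1≤m₁ 1≤m₂ d<m
    ...       | inj₁ d≤m₁ = containsExcursion-shift {f} 0 (*-monoʳ-≤ 2 (m≤m+n m₁ m₂))
                              (rec (m<m+n m₁ 1≤m₂) d≤m₁ ex₁)
    ...       | inj₂ d≤m₂ = containsExcursion-shift {f} (2 * m₁) (≤-reflexive (sym (*-distribˡ-+ 2 m₁ m₂)))
                              (rec (m<n+m m₂ 1≤m₁) d≤m₂ ex₂)
    go zero _ _ _ | inj₁ () | _
    go (suc m) rec {a} d≤m ex | inj₁ d<m | no noReturn =
      containsExcursion-shift {f} 1 (≤-trans (n≤1+n _) (≤-reflexive (sym (*-suc 2 m))))
        (rec ≤-refl (s≤s⁻¹ d<m)
          (excursion-inner (subst (Excursion f a) (*-suc 2 m) ex)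
            λ c 0<c c<2+2m ret → noReturn (c , subst (c <_) (sym (*-suc 2 m)) c<2+2m , 0<c , ret)))

-- If w returns to the same vertex after q steps, that repetition either lies
-- within the first j * q vertices or wraps around to w (j * q) ≡ w 0.
repetition⇒QRepeatingWalk : ∀ {n} q .{{_ : NonZero q}} {j} {w : ℕ → Fin n} → 2 ≤ j → w (j * q) ≡ w 0 →
  ∀ o → q + o ≤ j * q → w (q + o) ≡ w o → QRepeatingWalk q (j * q) w
repetition⇒QRepeatingWalk q {j} {w} 2≤j closed o q+o≤r w[q+o]≡wo with q + o <? j * q
... | yes q+o<r = o , q + o , m<n+m o (>-nonZero⁻¹ q) , q+o<r , sym (%-remove-+ˡ o (∣-refl {q})) , sym w[q+o]≡wo
... | no q+o≮r = 0 , o , 0<o , o<r , sym o%q≡0 , trans (sym closed) (trans (cong w (sym q+o≡r)) w[q+o]≡wo)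
  where
  q+o≡r : q + o ≡ j * q
  q+o≡r = ≤-antisym q+o≤r (≮⇒≥ q+o≮r)
  q<r : q < j * q
  q<r = subst (q <_) (*-comm q j) (m<m*n q j 2≤j)
  0<o : 0 < o
  0<o = n≢0⇒n>0 λ { refl → <-irrefl (trans (sym (+-identityʳ q)) q+o≡r) q<r }
  o<r : o < j * q
  o<r = subst (o <_) q+o≡r (m<n+m o (>-nonZero⁻¹ q))
  o%q≡0 : o % q ≡ 0 % q
  o%q≡0 = begin
    o % q       ≡⟨ %-remove-+ˡ o (∣-refl {q}) ⟨
    (q + o) % q ≡⟨ cong (_% q) q+o≡r ⟩
    (j * q) % q ≡⟨ m*n%n≡0 j q ⟩
    0           ≡⟨ m*n%n≡0 0 q ⟨
    0 % q       ∎
    where open ≡-Reasoning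

module _ {n : ℕ} (G : SimpleGraph n) where

  HasCycle : Set
  HasCycle = ∃[ k ] ∃[ c ] IsCycle G k c

  NonBacktrackingWalk : ℕ → (ℕ → Fin n) → Set
  NonBacktrackingWalk d c =
    (∀ i → i < d → Adj G (c i) (c (suc i))) × (∀ i → 2 + i ≤ d → c i ≢ c (2 + i))

  nonBacktracking-shift : ∀ {d c} a {l} → a + l ≤ d → NonBacktrackingWalk d c →
    NonBacktrackingWalk l (λ i → c (a + i))
  nonBacktracking-shift {d} {c} a {l} a+l≤d (adj , nb) = adj′ , nb′
    where
    inside : ∀ {i} → i ≤ l → a + i ≤ d
    inside i≤l = ≤-trans (+-monoʳ-≤ a i≤l) a+l≤d
    adj′ : ∀ i → i < l → Adj G (c (a + i)) (c (a + suc i))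
    adj′ i i<l rewrite +-suc a i = adj (a + i) (subst (_≤ d) (+-suc a i) (inside i<l))
    nb′ : ∀ i → 2 + i ≤ l → c (a + i) ≢ c (a + (2 + i))
    nb′ i 2+i≤l rewrite +-suc a (suc i) | +-suc a i =
      nb (a + i) (subst (_≤ d) (trans (+-suc a (suc i)) (cong suc (+-suc a i))) (inside 2+i≤l))

  closedNonBacktracking-length≥3 : ∀ {d c} → 1 ≤ d → c d ≡ c 0 → NonBacktrackingWalk d c → 3 ≤ d
  closedNonBacktracking-length≥3 {1} {c} _ c₁≡c₀ (adj , _) =
    ⊥-elim (irrefl G (subst (Adj G (c 0)) c₁≡c₀ (adj 0 ≤-refl)))
  closedNonBacktracking-length≥3 {2}     _ c₂≡c₀ (_ , nb)  = ⊥-elim (nb 0 ≤-refl (sym c₂≡c₀))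
  closedNonBacktracking-length≥3 {suc (suc (suc _))} _ _ _ = s≤s (s≤s (s≤s z≤n))

  -- A closed walk either repeats a vertex c a = c b with a < b < d, and then the
  -- shorter closed walk from a to b is again non-backtracking, or it is a cycle.
  closedNonBacktracking⇒cycle : ∀ d {c} → 1 ≤ d → c d ≡ c 0 → NonBacktrackingWalk d c → HasCycle
  closedNonBacktracking⇒cycle = <-rec _ go
    where
    go : ∀ d → (∀ {d′} → d′ < d → ∀ {c} → 1 ≤ d′ → c d′ ≡ c 0 → NonBacktrackingWalk d′ c → HasCycle) →
      ∀ {c} → 1 ≤ d → c d ≡ c 0 → NonBacktrackingWalk d c → HasCycle
    go d rec {c} 1≤d closed nb with anyUpTo? (λ b → anyUpTo? (λ a → c a Fin.≟ c b) b) d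
    ... | yes (b , b<d , a , a<b , ca≡cb) =
      rec (≤-<-trans (m∸n≤m b a) b<d) (m<n⇒0<n∸m a<b) closed′
          (nonBacktracking-shift a (subst (_≤ d) (sym (m+[n∸m]≡n a≤b)) (<⇒≤ b<d)) nb)
      where
      a≤b : a ≤ b
      a≤b = <⇒≤ a<b
      closed′ : c (a + (b ∸ a)) ≡ c (a + 0)
      closed′ = trans (cong c (m+[n∸m]≡n a≤b)) (trans (sym ca≡cb) (cong c (sym (+-identityʳ a))))
    ... | no noRepeat = d , c , closedNonBacktracking-length≥3 1≤d closed nb , (closed , proj₁ nb) , injective
      where
      injective : ∀ i j → i < d → j < d → c i ≡ c j → i ≡ j
      injective i j i<d j<d ci≡cj with <-cmp i j
      ... | tri< i<j _ _ = contradiction (j , j<d , i , i<j , ci≡cj) noRepeat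
      ... | tri≈ _ i≡j _ = i≡j
      ... | tri> _ _ j<i = contradiction (i , i<d , j , j<i , sym ci≡cj) noRepeat

  NotHead : Fin n → List (Fin n) → Set
  NotHead x []      = ⊤
  NotHead x (y ∷ _) = x ≢ y

  data Reduced (x : Fin n) : List (Fin n) → Set where
    []   : Reduced x []
    step : ∀ {y ys} → Adj G x y → NotHead x ys → Reduced y ys → Reduced x (y ∷ ys)

  walkOf : Fin n → List (Fin n) → ℕ → Fin n
  walkOf x []       _       = x
  walkOf x (_ ∷ _)  zero    = x
  walkOf x (y ∷ ys) (suc i) = walkOf y ys i

  walkOf-zero : ∀ x ys → walkOf x ys 0 ≡ x
  walkOf-zero x []      = refl
  walkOf-zero x (_ ∷ _) = refl

  lastVertex : Fin n → List (Fin n) → Fin n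
  lastVertex x ys = walkOf x ys (length ys)

  notHead⇒≢second : ∀ {x y} ys → 1 ≤ length ys → NotHead x ys → x ≢ walkOf y ys 1
  notHead⇒≢second (z ∷ zs) _ x≢z x≡ = x≢z (trans x≡ (walkOf-zero z zs))

  reduced⇒nonBacktracking : ∀ {x ys} → Reduced x ys → NonBacktrackingWalk (length ys) (walkOf x ys)
  reduced⇒nonBacktracking []                          = (λ _ ()) , (λ _ ())
  reduced⇒nonBacktracking {x} (step {y} {ys} x~y x∉ys r) = adj , nb
    where
    adj : ∀ i → i < suc (length ys) → Adj G (walkOf x (y ∷ ys) i) (walkOf x (y ∷ ys) (suc i))
    adj zero    _     = subst (Adj G x) (sym (walkOf-zero y ys)) x~y
    adj (suc i) i+1<l = proj₁ (reduced⇒nonBacktracking r) i (s≤s⁻¹ i+1<l)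
    nb : ∀ i → 2 + i ≤ suc (length ys) → walkOf x (y ∷ ys) i ≢ walkOf x (y ∷ ys) (2 + i)
    nb zero    2≤l   = notHead⇒≢second ys (s≤s⁻¹ 2≤l) x∉ys
    nb (suc i) 3+i≤l = proj₂ (reduced⇒nonBacktracking r) i (s≤s⁻¹ 3+i≤l)

  -- Stepping from x to v when x ∷ ys is the reduced walk back to the start:
  -- the step either cancels the previous one or extends the reduced walk.
  reduceStep : Fin n → Fin n → List (Fin n) → List (Fin n)
  reduceStep v x []       = x ∷ []
  reduceStep v x (y ∷ ys) with v Fin.≟ y
  ... | yes _ = ys
  ... | no  _ = x ∷ y ∷ ys

  reduceStep-reduced : ∀ {v x} ys → Adj G x v → Reduced x ys → Reduced v (reduceStep v x ys)
  reduceStep-reduced []       x~v _ = step (adj-sym G x~v) _ []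
  reduceStep-reduced {v} (y ∷ ys) x~v r@(step _ _ r′) with v Fin.≟ y
  ... | yes refl = r′
  ... | no v≢y   = step (adj-sym G x~v) v≢y r

  length-reduceStep : ∀ v x ys →
    length (reduceStep v x ys) ≡ suc (length ys) ⊎ suc (length (reduceStep v x ys)) ≡ length ys
  length-reduceStep v x []       = inj₁ refl
  length-reduceStep v x (y ∷ ys) with v Fin.≟ y
  ... | yes _ = inj₂ refl
  ... | no  _ = inj₁ refl

  lastVertex-reduceStep : ∀ {v x} ys → lastVertex v (reduceStep v x ys) ≡ lastVertex x ys
  lastVertex-reduceStep     []       = refl
  lastVertex-reduceStep {v} (y ∷ ys) with v Fin.≟ y
  ... | yes refl = refl
  ... | no  _    = refl

  suffix-reduceStep : ∀ {zs v x} ys → Suffix _≡_ zs (x ∷ ys) → length zs ≤ suc (length (reduceStep v x ys)) →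
    Suffix _≡_ zs (v ∷ reduceStep v x ys)
  suffix-reduceStep []       suf _ = there suf
  suffix-reduceStep {v = v} (y ∷ ys) suf bound with v Fin.≟ y
  suffix-reduceStep (y ∷ ys) (here zs≋) bound | yes refl =
    contradiction (subst (_≤ suc (length ys)) (Pointwise-length zs≋) bound) 1+n≰n
  suffix-reduceStep (y ∷ ys) (there suf) _ | yes refl = suf
  ... | no _ = there suf

  module Reduction (w : ℕ → Fin n) where

    -- w t ∷ trail t is the reduced form of the walk w 0, …, w t, read backwards.
    trail : ℕ → List (Fin n)
    trail zero    = []
    trail (suc t) = reduceStep (w (suc t)) (w t) (trail t)

    height : ℕ → ℕ
    height t = length (trail t)

    height-unitSteps : UnitSteps height
    height-unitSteps t = length-reduceStep (w (suc t)) (w t) (trail t)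

    trail-reduced : ∀ t → (∀ i → i < t → Adj G (w i) (w (suc i))) → Reduced (w t) (trail t)
    trail-reduced zero    _   = []
    trail-reduced (suc t) adj =
      reduceStep-reduced (trail t) (adj t ≤-refl) (trail-reduced t λ i i<t → adj i (m<n⇒m<1+n i<t))

    lastVertex-trail : ∀ t → lastVertex (w t) (trail t) ≡ w 0
    lastVertex-trail zero    = refl
    lastVertex-trail (suc t) = trans (lastVertex-reduceStep (trail t)) (lastVertex-trail t)

    -- While the height stays above its value at a, the reduced walk at a is
    -- never touched; it only gets extended and shortened back.
    excursion⇒suffix : ∀ {a l} → Excursion height a l → ∀ u → u ≤ l →
      Suffix _≡_ (w a ∷ trail a) (w (u + a) ∷ trail (u + a))
    excursion⇒suffix     _  zero    _     = here (≡⇒Pointwise-≡ refl)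
    excursion⇒suffix {a} ex (suc u) u<l =
      suffix-reduceStep (trail (u + a)) (excursion⇒suffix ex u (<⇒≤ u<l)) (s≤s (proj₂ ex (suc u) u<l))

    excursion⇒return : ∀ {a l} → Excursion height a l → w (l + a) ≡ w a
    excursion⇒return {a} {l} ex with toPointwise (cong suc (sym (proj₁ ex))) (excursion⇒suffix ex l ≤-refl)
    ... | wa≡w[l+a] ∷ _ = sym wa≡w[l+a]

    forest⇒trail≡[] : Forest G → ∀ r → IsClosedWalk G r w → trail r ≡ []
    forest⇒trail≡[] forest r (closed , adj) with trail r | trail-reduced r adj | lastVertex-trail r
    ... | []     | _       | _    = refl
    ... | y ∷ ys | reduced | last = contradiction
      (closedNonBacktracking⇒cycle (suc (length ys)) (s≤s z≤n) (trans last (sym closed)) (reduced⇒nonBacktracking reduced))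
      forest

  forest⇒QRepeating : Forest G → ∀ d → d ≤ 2 → ∀ q .{{_ : NonZero q}} → q ≡ 2 * d → QRepeating q G
  forest⇒QRepeating forest d d≤2 .(2 * d) refl j 2≤j w walk@(closed , _) =
    repetition (excursion⇒containsExcursion height-unitSteps d≤2 (j * d) (m≤n*m d j) whole)
    where
    open Reduction w
    instance
      j≢0 : NonZero j
      j≢0 = >-nonZero (≤-trans (s≤s z≤n) 2≤j)
    r≡2jd : j * (2 * d) ≡ 2 * (j * d)
    r≡2jd = trans (sym (*-assoc j 2 d)) (trans (cong (_* d) (*-comm j 2)) (*-assoc 2 j d))
    whole : Excursion height 0 (2 * (j * d))
    whole = trans (cong height (+-identityʳ (2 * (j * d))))
                  (cong length (subst (λ r → trail r ≡ []) r≡2jd (forest⇒trail≡[] forest _ walk))) ,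
            λ _ _ → z≤n
    repetition : ContainsExcursion height 0 (2 * (j * d)) (2 * d) → QRepeatingWalk (2 * d) (j * (2 * d)) w
    repetition (o , o+2d≤r , ex) = repetition⇒QRepeatingWalk (2 * d) 2≤j closed o
      (subst (2 * d + o ≤_) (sym r≡2jd) (subst (_≤ 2 * (j * d)) (+-comm o (2 * d)) o+2d≤r))
      (subst (λ b → w (2 * d + b) ≡ w b) (+-identityʳ o) (excursion⇒return ex))

  module _ {k c} .{{_ : NonZero k}} (cycle : IsCycle G k c) where

    private
      closed : c k ≡ c 0
      closed = proj₁ (proj₁ (proj₂ cycle))
      adj : ∀ i → i < k → Adj G (c i) (c (suc i))
      adj = proj₂ (proj₁ (proj₂ cycle))
      injective : ∀ i j → i < k → j < k → c i ≡ c j → i ≡ j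
      injective = proj₂ (proj₂ cycle)

    cycle-%-≡ : ∀ {x} → x ≤ k → c (x % k) ≡ c x
    cycle-%-≡ x≤k with m≤n⇒m<n∨m≡n x≤k
    ... | inj₁ x<k  = cong c (m<n⇒m%n≡m x<k)
    ... | inj₂ refl = trans (cong c (n%n≡0 k)) (sym closed)

    winding-closedWalk : ∀ r → k ∣ r → IsClosedWalk G r (λ t → c (t % k))
    winding-closedWalk r k∣r = cong c (trans (n∣m⇒m%n≡0 r k k∣r) (sym (m*n%n≡0 0 k))) , λ t _ → winding-adj t
      where
      winding-adj : ∀ t → Adj G (c (t % k)) (c (suc t % k))
      winding-adj t = subst (Adj G (c (t % k)))
        (trans (sym (cycle-%-≡ (m%n<n t k))) (cong c (sym ([1+m]%n≡[1+m%n]%n t k))))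
        (adj (t % k) (m%n<n t k))

    -- A q-repetition of the walk winding around the cycle happens at times
    -- congruent modulo q and modulo k, hence at least lcm q k apart.
    cycle⇒¬QRepeating : ∀ q .{{_ : NonZero q}} → ¬ (k ∣ q) → ¬ QRepeating q G
    cycle⇒¬QRepeating q k∤q repeating
      with n∤m⇒lcm[m,n]≡j*m∧2≤j q k k∤q
    ... | j , lcm≡jq , 2≤j
      with repeating j 2≤j _ (winding-closedWalk (j * q) (subst (k ∣_) lcm≡jq (n∣lcm[m,n] q k)))
    ... | t , t′ , t<t′ , t′<r , t≡t′[q] , ct≡ct′ = <-irrefl refl (begin-strict
      j * q   ≡⟨ lcm≡jq ⟨
      lcm q k ≤⟨ ∣⇒≤ {{>-nonZero (m<n⇒0<n∸m t<t′)}} lcm∣t′∸t ⟩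
      t′ ∸ t  ≤⟨ m∸n≤m t′ t ⟩
      t′      <⟨ t′<r ⟩
      j * q   ∎)
      where
      open ≤-Reasoning
      lcm∣t′∸t : lcm q k ∣ t′ ∸ t
      lcm∣t′∸t = lcm-least (%≡%⇒∣∸ q (<⇒≤ t<t′) t≡t′[q])
        (%≡%⇒∣∸ k (<⇒≤ t<t′) (injective _ _ (m%n<n t k) (m%n<n t′ k) ct≡ct′))

  -- Around a 4-cycle, c₀ c₁ c₀ c₁ c₂ c₃ c₂ c₃ c₀ is a closed walk of length 8
  -- whose vertices four steps apart are always opposite on the cycle.
  zigzag : (ℕ → Fin n) → ℕ → Fin n
  zigzag c 0 = c 0
  zigzag c 1 = c 1
  zigzag c 2 = c 0
  zigzag c 3 = c 1
  zigzag c 4 = c 2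
  zigzag c 5 = c 3
  zigzag c 6 = c 2
  zigzag c 7 = c 3
  zigzag c _ = c 0

  fourCycle⇒¬4-repeating : ∀ {c} → IsCycle G 4 c → ¬ QRepeating 4 G
  fourCycle⇒¬4-repeating {c} (_ , (closed , adj) , injective) repeating
    with repeating 2 ≤-refl (zigzag c) (refl , zigzag-adj)
    where
    c₀~c₁ : Adj G (c 0) (c 1)
    c₀~c₁ = adj 0 (s≤s z≤n)
    c₂~c₃ : Adj G (c 2) (c 3)
    c₂~c₃ = adj 2 (s≤s (s≤s (s≤s z≤n)))
    zigzag-adj : ∀ i → i < 8 → Adj G (zigzag c i) (zigzag c (suc i))
    zigzag-adj 0 _ = c₀~c₁
    zigzag-adj 1 _ = adj-sym G c₀~c₁
    zigzag-adj 2 _ = c₀~c₁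
    zigzag-adj 3 _ = adj 1 (s≤s (s≤s z≤n))
    zigzag-adj 4 _ = c₂~c₃
    zigzag-adj 5 _ = adj-sym G c₂~c₃
    zigzag-adj 6 _ = c₂~c₃
    zigzag-adj 7 _ = subst (Adj G (c 3)) closed (adj 3 ≤-refl)
    zigzag-adj (suc (suc (suc (suc (suc (suc (suc (suc i)))))))) i<8 = contradiction i<8 (m+n≮m 8 i)
  ... | t , t′ , t<t′ , t′<8 , t≡t′[4] , zt≡zt′ with congruent-below-2*q 4 t<t′ t′<8 t≡t′[4]
  ...   | refl = opposite t (+-cancelˡ-< 4 t 4 t′<8) zt≡zt′
    where
    c₀≢c₂ : c 0 ≢ c 2
    c₀≢c₂ c₀≡c₂ with injective 0 2 z<s (s≤s (s≤s (s≤s z≤n))) c₀≡c₂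
    ... | ()
    c₁≢c₃ : c 1 ≢ c 3
    c₁≢c₃ c₁≡c₃ with injective 1 3 (s≤s (s≤s z≤n)) ≤-refl c₁≡c₃
    ... | ()
    opposite : ∀ t → t < 4 → zigzag c t ≢ zigzag c (4 + t)
    opposite 0 _ = c₀≢c₂
    opposite 1 _ = c₁≢c₃
    opposite 2 _ = c₀≢c₂
    opposite 3 _ = c₁≢c₃
    opposite (suc (suc (suc (suc t)))) t<0 = contradiction t<0 (m+n≮m 4 t)

  QRepeating-2⇒forest : QRepeating 2 G → Forest G
  QRepeating-2⇒forest repeating (k , c , cycle@(3≤k , _)) =
    cycle⇒¬QRepeating {{>-nonZero (<-trans z<s 3≤k)}} cycle 2 (λ k∣2 → <⇒≱ 3≤k (∣⇒≤ k∣2)) repeating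

  QRepeating-4⇒forest : QRepeating 4 G → Forest G
  QRepeating-4⇒forest repeating (k , c , cycle@(3≤k , _)) with k ≟ 4
  ... | yes refl = fourCycle⇒¬4-repeating cycle repeating
  ... | no k≢4   = cycle⇒¬QRepeating {{>-nonZero (<-trans z<s 3≤k)}} cycle 4 (k≢4 ∘ divisor-of-4 3≤k) repeating

proposition8 : (n : ℕ) → (G : SimpleGraph n) →
    (Forest G ⇔ QRepeating 2 G) × (Forest G ⇔ QRepeating 4 G)
proposition8 n G =
  mk⇔ (λ forest → forest⇒QRepeating G forest 1 (s≤s z≤n) 2 refl) (QRepeating-2⇒forest G) ,
  mk⇔ (λ forest → forest⇒QRepeating G forest 2 ≤-refl 4 refl) (QRepeating-4⇒forest G)
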